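{- Let $G$ be a finite connected loopless graph with edge lengths $\ell$, $H$ its subdivision, $D$ a divisor on $H$, and $f_1,f_2\colon V(G)\to\mathbb{Z}$, $f:=f_1+f_2$. Let $\widetilde f$ and $\widetilde f_1$ be the canonical extensions of $f$ and $f_1$ with respect to $D$, and let $\widetilde f_2$ be the canonical extension of $f_2$ with respect to the divisor $D_1:=D+\operatorname{div}_\ell(f_1;D)$. Then $\widetilde f_1+\widetilde f_2=\widetilde f$. In particular, $\operatorname{div}_\ell(f;D)=\operatorname{div}_\ell(f_1;D)+\operatorname{div}_\ell(f_2;D_1)$.
   Context: $G$ is a finite connected loopless graph (multiple edges allowed) with lengths $\ell:E\to\mathbb{Z}_{>0}$; $H$ is obtained by replacing each oriented edge $e=uv$ by a path $u\,x^e_1\cdots x^e_{\ell_e-1}\,v$. Divisors on $H$ are integer combinations of vertices of $H$; $\operatorname{div}(F)(w)=\sum(F(w')-F(w))$ over edges of $H$ at $w$ with other endpoint $w'$. A divisor $D$ is $G$-admissible if for each oriented edge $e$ of $G$, $D(x^e_j)$ for $1\le j\le\ell_e-1$ is $0$ except for at most one $j$ where it is $1$. For any divisor $D$ and $f\colon V(G)\to\mathbb{Z}$ there is a unique extension $\widetilde f\colon V(H)\to\mathbb{Z}$ of $f$ with $D+\operatorname{div}(\widetilde f)$ $G$-admissible, the canonical extension of $f$ with respect to $D$; $\operatorname{div}_\ell(f;D):=\operatorname{div}(\widetilde f)$. -}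

module Defs where

open import Data.Nat as ℕ using (ℕ; zero; suc; pred; _<?_)
open import Data.Integer using (ℤ; _+_; _-_; _*_; +_)
open import Data.Fin using (Fin; fromℕ<; toℕ)
open import Data.Sum using (_⊎_; inj₁; inj₂)
open import Data.Product using (Σ; ∃; _×_; _,_)
open import Relation.Nullary using (¬_; yes; no)
open import Relation.Binary.PropositionalEquality using (_≡_; _≢_)
open import Relation.Binary.Construct.Closure.ReflexiveTransitive using (Star)
open import Data.Fin using (_≟_)

record Graph : Set where
  field
    n m       : ℕ
    src tgt   : Fin m → Fin n
    ℓ         : Fin m → ℕ
    ℓ-pos     : ∀ e → 1 ℕ.≤ ℓ e
    loopless  : ∀ e → src e ≢ tgt e
    connected : ∀ u v → Star (λ a b → ∃ λ e → (src e ≡ a × tgt e ≡ b) ⊎ (src e ≡ b × tgt e ≡ a)) u v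

open Graph public

-- Vertices of the subdivision H: vertices of G, plus the interior vertices
-- x^e_j (1 ≤ j ≤ ℓ e - 1), where (e , i) with i : Fin (ℓ e - 1) stands for x^e_{i+1}.
VH : Graph → Set
VH G = Fin (n G) ⊎ Σ (Fin (m G)) (λ e → Fin (pred (ℓ G e)))

-- The k-th vertex of the path replacing e (k = 0 : src e, k = ℓ e : tgt e).
pt : (G : Graph) → Fin (m G) → ℕ → VH G
pt G e zero = inj₁ (src G e)
pt G e (suc k) with k <? pred (ℓ G e)
... | yes p = inj₂ (e , fromℕ< p)
... | no _  = inj₁ (tgt G e)

Divisor : Graph → Set
Divisor G = VH G → ℤ

_⊕_ : {G : Graph} → Divisor G → Divisor G → Divisor G
(D ⊕ E) w = D w + E w

sumFin : ∀ {k} → (Fin k → ℤ) → ℤ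
sumFin {zero}  g = + 0
sumFin {suc k} g = g Fin.zero + sumFin (λ i → g (Fin.suc i))

[_≟ᶠ_]·_ : ∀ {k} → Fin k → Fin k → ℤ → ℤ
[ a ≟ᶠ b ]· z with a ≟ b
... | yes _ = z
... | no  _ = + 0

-- div(F)(w) = Σ_{edges ww' of H} (F(w') - F(w)).
div : (G : Graph) → (VH G → ℤ) → Divisor G
div G F (inj₁ u) = sumFin (λ e →
    ([ src G e ≟ᶠ u ]· (F (pt G e 1) - F (inj₁ u)))
  + ([ tgt G e ≟ᶠ u ]· (F (pt G e (pred (ℓ G e))) - F (inj₁ u))))
div G F (inj₂ (e , i)) =
  (F (pt G e (toℕ i)) - F (inj₂ (e , i)))
  + (F (pt G e (suc (suc (toℕ i)))) - F (inj₂ (e , i)))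

Admissible : (G : Graph) → Divisor G → Set
Admissible G D = ∀ e →
    (∀ i → D (inj₂ (e , i)) ≡ + 0 ⊎ D (inj₂ (e , i)) ≡ + 1)
  × (∀ i j → D (inj₂ (e , i)) ≡ + 1 → D (inj₂ (e , j)) ≡ + 1 → i ≡ j)

IsCanonicalExtension : (G : Graph) → Divisor G → (Fin (n G) → ℤ) → (VH G → ℤ) → Set
IsCanonicalExtension G D f F = (∀ u → F (inj₁ u) ≡ f u) × Admissible G (_⊕_ {G} D (div G F))

-- On each edge e, the difference g of two canonical extensions of the same f vanishes at both
-- endpoints, and its second difference is a − b, where a and b are 0/1 sequences each with at
-- most one 1. The partial sums of a and b are monotone with values in {0,1}, so any two slopes
-- Δg j, Δg k differ by at most 1. A positive slope would therefore make all slopes nonnegative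
-- and g strictly increasing somewhere, contradicting g 0 = g ℓ; by symmetry no slope is
-- negative either, so g = 0. Canonical extensions are thus unique, and since div is additive,
-- F₁ + F₂ is a canonical extension of f₁ + f₂ with respect to D.
module Submission where

open import Defs
open import Data.Nat as ℕ using (ℕ; zero; suc; pred; z≤n; s≤s)
import Data.Nat.Properties as ℕ
open import Data.Fin as Fin using (Fin; toℕ; fromℕ<)
open import Data.Fin.Properties using (toℕ-fromℕ<; fromℕ<-toℕ; toℕ<n)
open import Data.Integer using (ℤ; _+_; _-_; -_; 0ℤ; 1ℤ; _≤_; _<_; +≤+)
open import Data.Integer.Properties
open import Data.Integer.Tactic.RingSolver using (solve-∀)
open import Data.Sum using (_⊎_; inj₁; inj₂)
open import Data.Product using (∃-syntax; _×_; _,_; proj₁; proj₂)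
open import Function using (_∘_)
open import Relation.Nullary using (yes; no; contradiction)
open import Relation.Binary.PropositionalEquality
open import Algebra.Properties.CommutativeSemigroup +-commutativeSemigroup using (interchange)

+-sub-interchange : ∀ x₁ x₂ y₁ y₂ → (x₁ + x₂) - (y₁ + y₂) ≡ (x₁ - y₁) + (x₂ - y₂)
+-sub-interchange x₁ x₂ y₁ y₂ =
  trans (cong (x₁ + x₂ +_) (neg-distrib-+ y₁ y₂)) (interchange x₁ x₂ (- y₁) (- y₂))

Δ : (ℕ → ℤ) → ℕ → ℤ
Δ g k = g (suc k) - g k

partialSum : (ℕ → ℤ) → ℕ → ℤ
partialSum h zero    = 0ℤ
partialSum h (suc k) = partialSum h k + h k

partialSum-Δ : ∀ g k → partialSum (Δ g) k ≡ g k - g 0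
partialSum-Δ g zero    = sym (+-inverseʳ (g 0))
partialSum-Δ g (suc k) = begin
  partialSum (Δ g) k + Δ g k          ≡⟨ cong (_+ Δ g k) (partialSum-Δ g k) ⟩
  (g k - g 0) + (g (suc k) - g k)     ≡⟨ +-comm (g k - g 0) (g (suc k) - g k) ⟩
  (g (suc k) - g k) + (g k - g 0)     ≡⟨ +-minus-telescope (g (suc k)) (g k) (g 0) ⟩
  g (suc k) - g 0                     ∎
  where open ≡-Reasoning

partialSum-cong : ∀ {h h′} k → (∀ m → m ℕ.< k → h m ≡ h′ m) → partialSum h k ≡ partialSum h′ k
partialSum-cong zero    _ = refl
partialSum-cong (suc k) h≡h′ =
  cong₂ _+_ (partialSum-cong k (λ m m<k → h≡h′ m (ℕ.m<n⇒m<1+n m<k))) (h≡h′ k ℕ.≤-refl)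

partialSum-- : ∀ a b k → partialSum (λ m → a m - b m) k ≡ partialSum a k - partialSum b k
partialSum-- a b zero    = refl
partialSum-- a b (suc k) = begin
  partialSum (λ m → a m - b m) k + (a k - b k)            ≡⟨ cong (_+ (a k - b k)) (partialSum-- a b k) ⟩
  (partialSum a k - partialSum b k) + (a k - b k)         ≡⟨ sym (+-sub-interchange (partialSum a k) (a k) (partialSum b k) (b k)) ⟩
  (partialSum a k + a k) - (partialSum b k + b k)         ∎
  where open ≡-Reasoning

partialSum-mono : ∀ {h j} k → (∀ m → m ℕ.< k → 0ℤ ≤ h m) → j ℕ.≤ k → partialSum h j ≤ partialSum h k
partialSum-mono zero    _ z≤n = ≤-refl
partialSum-mono {h} (suc k) h≥0 j≤1+k with ℕ.m≤n⇒m<n∨m≡n j≤1+k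
... | inj₂ refl      = ≤-refl
... | inj₁ (s≤s j≤k) = ≤-trans (partialSum-mono k (λ m m<k → h≥0 m (ℕ.m<n⇒m<1+n m<k)) j≤k)
    (≤-trans (≤-reflexive (sym (+-identityʳ (partialSum h k)))) (+-monoʳ-≤ (partialSum h k) (h≥0 k ℕ.≤-refl)))

-- Admissible G D unfolds to ∀ e → IndicatorOfAtMostOne (λ i → D (inj₂ (e , i))).
IndicatorOfAtMostOne : {I : Set} → (I → ℤ) → Set
IndicatorOfAtMostOne h = (∀ i → h i ≡ 0ℤ ⊎ h i ≡ 1ℤ) × (∀ i j → h i ≡ 1ℤ → h j ≡ 1ℤ → i ≡ j)

indicator-cong : ∀ {I : Set} {h h′ : I → ℤ} → (∀ i → h i ≡ h′ i) →
  IndicatorOfAtMostOne h → IndicatorOfAtMostOne h′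
indicator-cong h≡h′ (h01 , h-unique) =
  (λ i → subst (λ z → z ≡ 0ℤ ⊎ z ≡ 1ℤ) (h≡h′ i) (h01 i)) ,
  (λ i j h′i≡1 h′j≡1 → h-unique i j (trans (h≡h′ i) h′i≡1) (trans (h≡h′ j) h′j≡1))

module IndicatorPartialSums {h : ℕ → ℤ} (h-ind : IndicatorOfAtMostOne h) where

  private
    h01 = proj₁ h-ind
    h-unique = proj₂ h-ind

  0≤h : ∀ m → 0ℤ ≤ h m
  0≤h m with h01 m
  ... | inj₁ hm≡0 = ≤-reflexive (sym hm≡0)
  ... | inj₂ hm≡1 = ≤-trans (+≤+ z≤n) (≤-reflexive (sym hm≡1))

  partialSum-cases : ∀ k → partialSum h k ≡ 0ℤ ⊎ (partialSum h k ≡ 1ℤ × ∃[ m ] m ℕ.< k × h m ≡ 1ℤ)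
  partialSum-cases zero = inj₁ refl
  partialSum-cases (suc k) with partialSum-cases k | h01 k
  ... | inj₁ s≡0              | inj₁ hk≡0 = inj₁ (cong₂ _+_ s≡0 hk≡0)
  ... | inj₁ s≡0              | inj₂ hk≡1 = inj₂ (cong₂ _+_ s≡0 hk≡1 , k , ℕ.≤-refl , hk≡1)
  ... | inj₂ (s≡1 , m , m<k , hm≡1) | inj₁ hk≡0 = inj₂ (cong₂ _+_ s≡1 hk≡0 , m , ℕ.m<n⇒m<1+n m<k , hm≡1)
  ... | inj₂ (_ , m , m<k , hm≡1)   | inj₂ hk≡1 = contradiction (h-unique m k hm≡1 hk≡1) (ℕ.<⇒≢ m<k)

  partialSum≤1 : ∀ k → partialSum h k ≤ 1ℤ
  partialSum≤1 k with partialSum-cases k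
  ... | inj₁ s≡0       = ≤-trans (≤-reflexive s≡0) (+≤+ z≤n)
  ... | inj₂ (s≡1 , _) = ≤-reflexive s≡1

  partialSum-monotone : ∀ {j k} → j ℕ.≤ k → partialSum h j ≤ partialSum h k
  partialSum-monotone {k = k} = partialSum-mono k (λ m _ → 0≤h m)

  partialSum-gap≤1 : ∀ j k → partialSum h j - partialSum h k ≤ 1ℤ
  partialSum-gap≤1 j k = +-mono-≤ (partialSum≤1 j) (neg-mono-≤ (partialSum-monotone {k = k} z≤n))

  partialSum-gap≤0 : ∀ {j k} → j ℕ.≤ k → partialSum h j - partialSum h k ≤ 0ℤ
  partialSum-gap≤0 = i≤j⇒i-j≤0 ∘ partialSum-monotone

module TwoPointBoundaryProblem (L : ℕ) (g a b : ℕ → ℤ)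
  (a-ind : IndicatorOfAtMostOne a) (b-ind : IndicatorOfAtMostOne b)
  (g0≡0 : g 0 ≡ 0ℤ) (gL≡0 : g L ≡ 0ℤ)
  (Δ²g : ∀ m → 2 ℕ.+ m ℕ.≤ L → Δ (Δ g) m ≡ a m - b m) where

  private
    module A = IndicatorPartialSums a-ind
    module B = IndicatorPartialSums b-ind

  Δ-formula : ∀ k → k ℕ.< L → Δ g k ≡ Δ g 0 + (partialSum a k - partialSum b k)
  Δ-formula k k<L = begin
    Δ g k                                      ≡⟨ shift (Δ g 0) (Δ g k) ⟩
    Δ g 0 + (Δ g k - Δ g 0)                    ≡⟨ cong (Δ g 0 +_) (sym (partialSum-Δ (Δ g) k)) ⟩
    Δ g 0 + partialSum (Δ (Δ g)) k             ≡⟨ cong (Δ g 0 +_) (partialSum-cong k (λ m m<k → Δ²g m (ℕ.≤-trans (s≤s m<k) k<L))) ⟩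
    Δ g 0 + partialSum (λ m → a m - b m) k     ≡⟨ cong (Δ g 0 +_) (partialSum-- a b k) ⟩
    Δ g 0 + (partialSum a k - partialSum b k)  ∎
    where
    open ≡-Reasoning
    shift : ∀ x y → y ≡ x + (y - x)
    shift = solve-∀

  Δ-spread : ∀ j k → j ℕ.< L → k ℕ.< L → Δ g j - 1ℤ ≤ Δ g k
  Δ-spread j k j<L k<L = i-j≤0⇒i≤j (begin
    Δ g j - 1ℤ - Δ g k
      ≡⟨ cong₂ (λ x y → x - 1ℤ - y) (Δ-formula j j<L) (Δ-formula k k<L) ⟩
    Δ g 0 + (Sa j - Sb j) - 1ℤ - (Δ g 0 + (Sa k - Sb k))
      ≡⟨ regroup (Δ g 0) (Sa j) (Sb j) (Sa k) (Sb k) ⟩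
    ((Sa j - Sa k) + (Sb k - Sb j)) - 1ℤ
      ≤⟨ i≤j⇒i-j≤0 gaps≤1 ⟩
    0ℤ ∎)
    where
    open ≤-Reasoning
    Sa = partialSum a
    Sb = partialSum b
    regroup : ∀ c x y u v → c + (x - y) - 1ℤ - (c + (u - v)) ≡ ((x - u) + (v - y)) - 1ℤ
    regroup = solve-∀
    gaps≤1 : (Sa j - Sa k) + (Sb k - Sb j) ≤ 1ℤ
    gaps≤1 with ℕ.≤-total j k
    ... | inj₁ j≤k = +-mono-≤ (A.partialSum-gap≤0 j≤k) (B.partialSum-gap≤1 k j)
    ... | inj₂ k≤j = +-mono-≤ (A.partialSum-gap≤1 j k) (B.partialSum-gap≤0 k≤j)

  Δ≤0 : ∀ j → j ℕ.< L → Δ g j ≤ 0ℤ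
  Δ≤0 j j<L = ≮⇒≥ λ Δgj>0 → <-irrefl (sym total≡0) (total>0 Δgj>0)
    where
    total≡0 : partialSum (Δ g) L ≡ 0ℤ
    total≡0 = trans (partialSum-Δ g L) (cong₂ _-_ gL≡0 g0≡0)
    total>0 : 0ℤ < Δ g j → 0ℤ < partialSum (Δ g) L
    total>0 Δgj>0 = begin-strict
      0ℤ                              ≤⟨ partialSum-mono j (λ m m<j → Δg≥0 m (ℕ.<-trans m<j j<L)) z≤n ⟩
      partialSum (Δ g) j              ≡⟨ sym (+-identityʳ _) ⟩
      partialSum (Δ g) j + 0ℤ         <⟨ +-monoʳ-< (partialSum (Δ g) j) Δgj>0 ⟩
      partialSum (Δ g) (suc j)        ≤⟨ partialSum-mono L Δg≥0 j<L ⟩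
      partialSum (Δ g) L              ∎
      where
      open ≤-Reasoning
      Δg≥0 : ∀ k → k ℕ.< L → 0ℤ ≤ Δ g k
      Δg≥0 k k<L = ≤-trans (i≤j⇒0≤j-i (i<j⇒suc[i]≤j Δgj>0)) (Δ-spread j k j<L k<L)

vanishes-on-interval : ∀ L (g a b : ℕ → ℤ) → IndicatorOfAtMostOne a → IndicatorOfAtMostOne b →
  g 0 ≡ 0ℤ → g L ≡ 0ℤ → (∀ m → 2 ℕ.+ m ℕ.≤ L → Δ (Δ g) m ≡ a m - b m) →
  ∀ k → k ℕ.≤ L → g k ≡ 0ℤ
vanishes-on-interval L g a b a-ind b-ind g0≡0 gL≡0 Δ²g = g≡0
  where
  open TwoPointBoundaryProblem L g a b a-ind b-ind g0≡0 gL≡0 Δ²g using (Δ≤0)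

  Δ²[-g] : ∀ m → 2 ℕ.+ m ℕ.≤ L → Δ (Δ (-_ ∘ g)) m ≡ b m - a m
  Δ²[-g] m 2+m≤L = begin
    Δ (Δ (-_ ∘ g)) m    ≡⟨ neg-Δ² (g m) (g (suc m)) (g (2 ℕ.+ m)) ⟩
    - Δ (Δ g) m         ≡⟨ cong -_ (Δ²g m 2+m≤L) ⟩
    - (a m - b m)       ≡⟨ neg-sub (a m) (b m) ⟩
    b m - a m           ∎
    where
    open ≡-Reasoning
    neg-Δ² : ∀ x y z → (- z - - y) - (- y - - x) ≡ - ((z - y) - (y - x))
    neg-Δ² = solve-∀
    neg-sub : ∀ x y → - (x - y) ≡ y - x
    neg-sub = solve-∀

  module Negated = TwoPointBoundaryProblem L (-_ ∘ g) b a b-ind a-ind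
    (cong -_ g0≡0) (cong -_ gL≡0) Δ²[-g]

  Δg≡0 : ∀ k → k ℕ.< L → Δ g k ≡ 0ℤ
  Δg≡0 k k<L = ≤-antisym (Δ≤0 k k<L)
    (neg-cancel-≤ (≤-trans (≤-reflexive (neg-distrib-+ (g (suc k)) (- g k))) (Negated.Δ≤0 k k<L)))

  g≡0 : ∀ k → k ℕ.≤ L → g k ≡ 0ℤ
  g≡0 k k≤L = trans (i-j≡0⇒i≡j (g k) (g 0) (begin
    g k - g 0                ≡⟨ sym (partialSum-Δ g k) ⟩
    partialSum (Δ g) k       ≡⟨ partialSum-cong k (λ m m<k → Δg≡0 m (ℕ.<-≤-trans m<k k≤L)) ⟩
    partialSum (λ _ → 0ℤ) k  ≡⟨ partialSum-zero k ⟩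
    0ℤ                       ∎)) g0≡0
    where
    open ≡-Reasoning
    partialSum-zero : ∀ k → partialSum (λ _ → 0ℤ) k ≡ 0ℤ
    partialSum-zero zero    = refl
    partialSum-zero (suc k) = cong (_+ 0ℤ) (partialSum-zero k)

extendByZero : ∀ {N} → (Fin N → ℤ) → ℕ → ℤ
extendByZero {N} h k with k ℕ.<? N
... | yes k<N = h (fromℕ< k<N)
... | no  _   = 0ℤ

extendByZero-fromℕ< : ∀ {N} (h : Fin N → ℤ) {k} (k<N : k ℕ.< N) → extendByZero h k ≡ h (fromℕ< k<N)
extendByZero-fromℕ< {N} h {k} k<N with k ℕ.<? N
... | yes _    = refl
... | no  k≮N  = contradiction k<N k≮N

extendByZero-indicator : ∀ {N} {h : Fin N → ℤ} → IndicatorOfAtMostOne h → IndicatorOfAtMostOne (extendByZero h)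
extendByZero-indicator {N} {h} (h01 , h-unique) = h′01 , h′-unique
  where
  h′01 : ∀ k → extendByZero h k ≡ 0ℤ ⊎ extendByZero h k ≡ 1ℤ
  h′01 k with k ℕ.<? N
  ... | yes k<N = h01 (fromℕ< k<N)
  ... | no  _   = inj₁ refl
  h′-unique : ∀ j k → extendByZero h j ≡ 1ℤ → extendByZero h k ≡ 1ℤ → j ≡ k
  h′-unique j k with j ℕ.<? N | k ℕ.<? N
  ... | yes j<N | yes k<N = λ hj≡1 hk≡1 →
    trans (sym (toℕ-fromℕ< j<N)) (trans (cong toℕ (h-unique _ _ hj≡1 hk≡1)) (toℕ-fromℕ< k<N))
  ... | yes _   | no _    = λ _ ()
  ... | no _    | _       = λ ()

sumFin-cong : ∀ {k} {g h : Fin k → ℤ} → (∀ i → g i ≡ h i) → sumFin g ≡ sumFin h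
sumFin-cong {zero}  _   = refl
sumFin-cong {suc k} g≡h = cong₂ _+_ (g≡h Fin.zero) (sumFin-cong (g≡h ∘ Fin.suc))

sumFin-+ : ∀ {k} (g h : Fin k → ℤ) → sumFin (λ i → g i + h i) ≡ sumFin g + sumFin h
sumFin-+ {zero}  g h = refl
sumFin-+ {suc k} g h = trans (cong (g Fin.zero + h Fin.zero +_) (sumFin-+ (g ∘ Fin.suc) (h ∘ Fin.suc)))
                             (interchange (g Fin.zero) (h Fin.zero) (sumFin (g ∘ Fin.suc)) (sumFin (h ∘ Fin.suc)))

[≟ᶠ]·-+ : ∀ {k} (i j : Fin k) x y → [ i ≟ᶠ j ]· (x + y) ≡ [ i ≟ᶠ j ]· x + [ i ≟ᶠ j ]· y
[≟ᶠ]·-+ i j x y with i Fin.≟ j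
... | yes _ = refl
... | no  _ = refl

module Subdivision (G : Graph) where

  along : (VH G → ℤ) → Fin (m G) → ℕ → ℤ
  along F e k = F (pt G e k)

  pt-interior : ∀ e {k} (k<ℓ-1 : k ℕ.< pred (ℓ G e)) → pt G e (suc k) ≡ inj₂ (e , fromℕ< k<ℓ-1)
  pt-interior e {k} k<ℓ-1 with k ℕ.<? pred (ℓ G e)
  ... | yes _     = refl
  ... | no  k≮ℓ-1 = contradiction k<ℓ-1 k≮ℓ-1

  pt-suc-toℕ : ∀ e (i : Fin (pred (ℓ G e))) → pt G e (suc (toℕ i)) ≡ inj₂ (e , i)
  pt-suc-toℕ e i = trans (pt-interior e (toℕ<n i)) (cong (λ j → inj₂ (e , j)) (fromℕ<-toℕ i (toℕ<n i)))

  pt-ℓ : ∀ e → pt G e (ℓ G e) ≡ inj₁ (tgt G e)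
  pt-ℓ e = subst (λ k → pt G e k ≡ inj₁ (tgt G e))
                 (ℕ.suc-pred (ℓ G e) {{ℕ.>-nonZero (ℓ-pos G e)}}) pt-last
    where
    pt-last : pt G e (suc (pred (ℓ G e))) ≡ inj₁ (tgt G e)
    pt-last with pred (ℓ G e) ℕ.<? pred (ℓ G e)
    ... | yes ℓ-1<ℓ-1 = contradiction ℓ-1<ℓ-1 (ℕ.<-irrefl refl)
    ... | no  _       = refl

  div-interior : ∀ F e {k} (k<ℓ-1 : k ℕ.< pred (ℓ G e)) →
    div G F (inj₂ (e , fromℕ< k<ℓ-1)) ≡ Δ (Δ (along F e)) k
  div-interior F e {k} k<ℓ-1 = begin
    (F (pt G e (toℕ x)) - F y) + (F (pt G e (2 ℕ.+ toℕ x)) - F y)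
      ≡⟨ cong (λ j → (F (pt G e j) - F y) + (F (pt G e (2 ℕ.+ j)) - F y)) (toℕ-fromℕ< k<ℓ-1) ⟩
    (φ k - F y) + (φ (2 ℕ.+ k) - F y)
      ≡⟨ cong (λ z → (φ k - F z) + (φ (2 ℕ.+ k) - F z)) (sym (pt-interior e k<ℓ-1)) ⟩
    (φ k - φ (1 ℕ.+ k)) + (φ (2 ℕ.+ k) - φ (1 ℕ.+ k))
      ≡⟨ second-difference (φ k) (φ (1 ℕ.+ k)) (φ (2 ℕ.+ k)) ⟩
    Δ (Δ φ) k
      ∎
    where
    open ≡-Reasoning
    φ = along F e
    x = fromℕ< k<ℓ-1
    y = inj₂ (e , x)
    second-difference : ∀ u v w → (u - v) + (w - v) ≡ (w - v) - (v - u)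
    second-difference = solve-∀

  canonicalExtension-unique : ∀ {D f F F′} → IsCanonicalExtension G D f F → IsCanonicalExtension G D f F′ →
    ∀ w → F w ≡ F′ w
  canonicalExtension-unique (ext , _) (ext′ , _) (inj₁ u) = trans (ext u) (sym (ext′ u))
  canonicalExtension-unique {D} {f} {F} {F′} (ext , adm) (ext′ , adm′) (inj₂ (e , i)) =
    i-j≡0⇒i≡j _ _ (trans (cong (λ w → F w - F′ w) (sym (pt-suc-toℕ e i)))
                         (g≡0 (suc (toℕ i)) (ℕ.≤-trans (toℕ<n i) ℕ.pred[n]≤n)))
    where
    g a b : ℕ → ℤ
    g k = along F e k - along F′ e k
    a = extendByZero (λ j → (_⊕_ {G} D (div G F)) (inj₂ (e , j)))
    b = extendByZero (λ j → (_⊕_ {G} D (div G F′)) (inj₂ (e , j)))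
    endpoint : ∀ v → F (inj₁ v) - F′ (inj₁ v) ≡ 0ℤ
    endpoint v = trans (cong₂ _-_ (ext v) (ext′ v)) (+-inverseʳ (f v))
    gℓ≡0 : g (ℓ G e) ≡ 0ℤ
    gℓ≡0 = trans (cong (λ w → F w - F′ w) (pt-ℓ e)) (endpoint (tgt G e))
    Δ²g : ∀ m → 2 ℕ.+ m ℕ.≤ ℓ G e → Δ (Δ g) m ≡ a m - b m
    Δ²g m 2+m≤ℓ = begin
      Δ (Δ g) m                                    ≡⟨ Δ²-sub (along F e m) (along F e (1 ℕ.+ m)) (along F e (2 ℕ.+ m))
                                                               (along F′ e m) (along F′ e (1 ℕ.+ m)) (along F′ e (2 ℕ.+ m)) ⟩
      Δ (Δ (along F e)) m - Δ (Δ (along F′ e)) m   ≡⟨ sym (cong₂ _-_ (div-interior F e m<ℓ-1) (div-interior F′ e m<ℓ-1)) ⟩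
      div G F x - div G F′ x                       ≡⟨ sym (+-cancelˡ-sub (D x) (div G F x) (div G F′ x)) ⟩
      (D x + div G F x) - (D x + div G F′ x)       ≡⟨ sym (cong₂ _-_ (extendByZero-fromℕ< _ m<ℓ-1) (extendByZero-fromℕ< _ m<ℓ-1)) ⟩
      a m - b m                                    ∎
      where
      open ≡-Reasoning
      m<ℓ-1 : m ℕ.< pred (ℓ G e)
      m<ℓ-1 = ℕ.pred-mono-≤ 2+m≤ℓ
      x : VH G
      x = inj₂ (e , fromℕ< m<ℓ-1)
      Δ²-sub : ∀ u v w u′ v′ w′ → ((w - w′) - (v - v′)) - ((v - v′) - (u - u′)) ≡ ((w - v) - (v - u)) - ((w′ - v′) - (v′ - u′))
      Δ²-sub = solve-∀
      +-cancelˡ-sub : ∀ c y z → (c + y) - (c + z) ≡ y - z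
      +-cancelˡ-sub = solve-∀
    g≡0 : ∀ k → k ℕ.≤ ℓ G e → g k ≡ 0ℤ
    g≡0 = vanishes-on-interval (ℓ G e) g a b (extendByZero-indicator (adm e)) (extendByZero-indicator (adm′ e))
                               (endpoint (src G e)) gℓ≡0 Δ²g

  div-cong : ∀ {F F′} → (∀ w → F w ≡ F′ w) → ∀ w → div G F w ≡ div G F′ w
  div-cong F≡F′ (inj₁ u) = sumFin-cong λ e →
    cong₂ _+_ (cong ([ src G e ≟ᶠ u ]·_) (cong₂ _-_ (F≡F′ _) (F≡F′ _)))
              (cong ([ tgt G e ≟ᶠ u ]·_) (cong₂ _-_ (F≡F′ _) (F≡F′ _)))
  div-cong F≡F′ (inj₂ _) = cong₂ _+_ (cong₂ _-_ (F≡F′ _) (F≡F′ _)) (cong₂ _-_ (F≡F′ _) (F≡F′ _))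

  div-+ : ∀ F₁ F₂ w → div G (λ v → F₁ v + F₂ v) w ≡ div G F₁ w + div G F₂ w
  div-+ F₁ F₂ (inj₁ u) = trans (sumFin-cong term-+) (sumFin-+ (term F₁) (term F₂))
    where
    slope : (VH G → ℤ) → Fin (n G) → VH G → ℤ
    slope F v w = [ v ≟ᶠ u ]· (F w - F (inj₁ u))
    term : (VH G → ℤ) → Fin (m G) → ℤ
    term F e = slope F (src G e) (pt G e 1) + slope F (tgt G e) (pt G e (pred (ℓ G e)))
    slope-+ : ∀ v w → slope (λ x → F₁ x + F₂ x) v w ≡ slope F₁ v w + slope F₂ v w
    slope-+ v w = trans (cong ([ v ≟ᶠ u ]·_) (+-sub-interchange (F₁ w) (F₂ w) (F₁ (inj₁ u)) (F₂ (inj₁ u))))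
                        ([≟ᶠ]·-+ v u (F₁ w - F₁ (inj₁ u)) (F₂ w - F₂ (inj₁ u)))
    term-+ : ∀ e → term (λ x → F₁ x + F₂ x) e ≡ term F₁ e + term F₂ e
    term-+ e = trans (cong₂ _+_ (slope-+ s x) (slope-+ t y))
                     (interchange (slope F₁ s x) (slope F₂ s x) (slope F₁ t y) (slope F₂ t y))
      where
      s = src G e
      t = tgt G e
      x = pt G e 1
      y = pt G e (pred (ℓ G e))
  div-+ F₁ F₂ (inj₂ (e , i)) =
    trans (cong₂ _+_ (+-sub-interchange (F₁ x) (F₂ x) (F₁ c) (F₂ c)) (+-sub-interchange (F₁ y) (F₂ y) (F₁ c) (F₂ c)))
          (interchange (F₁ x - F₁ c) (F₂ x - F₂ c) (F₁ y - F₁ c) (F₂ y - F₂ c))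
    where
    c = inj₂ (e , i)
    x = pt G e (toℕ i)
    y = pt G e (2 ℕ.+ toℕ i)

  admissible-cong : ∀ {D D′} → (∀ w → D w ≡ D′ w) → Admissible G D → Admissible G D′
  admissible-cong D≡D′ adm e = indicator-cong (λ i → D≡D′ (inj₂ (e , i))) (adm e)

  canonicalExtension-+ : ∀ {D f₁ f₂ F₁ F₂} →
    IsCanonicalExtension G D f₁ F₁ → IsCanonicalExtension G (_⊕_ {G} D (div G F₁)) f₂ F₂ →
    IsCanonicalExtension G D (λ u → f₁ u + f₂ u) (λ w → F₁ w + F₂ w)
  canonicalExtension-+ {D} {F₁ = F₁} {F₂} (ext₁ , _) (ext₂ , adm₂) =
    (λ u → cong₂ _+_ (ext₁ u) (ext₂ u)) ,
    admissible-cong (λ w → trans (+-assoc (D w) (div G F₁ w) (div G F₂ w)) (cong (D w +_) (sym (div-+ F₁ F₂ w)))) adm₂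

proposition2p11 : (G : Graph) (D : Divisor G) (f₁ f₂ : Fin (n G) → ℤ)
    (F F₁ F₂ : VH G → ℤ)
    → IsCanonicalExtension G D (λ u → f₁ u + f₂ u) F
    → IsCanonicalExtension G D f₁ F₁
    → IsCanonicalExtension G (_⊕_ {G} D (div G F₁)) f₂ F₂
    → (∀ w → F₁ w + F₂ w ≡ F w)
      × (∀ w → div G F w ≡ div G F₁ w + div G F₂ w)
proposition2p11 G D f₁ f₂ F F₁ F₂ F-canonical F₁-canonical F₂-canonical = F₁+F₂≡F , div-split
  where
  open Subdivision G
  F₁+F₂≡F : ∀ w → F₁ w + F₂ w ≡ F w
  F₁+F₂≡F = canonicalExtension-unique {D}
    (canonicalExtension-+ {D} {F₁ = F₁} {F₂} F₁-canonical F₂-canonical) F-canonical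
  div-split : ∀ w → div G F w ≡ div G F₁ w + div G F₂ w
  div-split w = trans (div-cong (sym ∘ F₁+F₂≡F) w) (div-+ F₁ F₂ w)
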